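{- Let $\alpha=(1+\sqrt{5})/2$ and $\beta=(1-\sqrt{5})/2$. Let $n,j,q$ be integers with $n\geq 1$, $j\geq 1$ and $q\geq 2$. Then $$\sum_{k=0}^n\binom{n}{k}(\sqrt{5}F_j)^{n-k}\bigl(q^{1-(n-k)}-1\bigr)F_{jk}\,B_{n-k} = nF_j\,q^{1-n}\sum_{r=1}^{q-1}\bigl(r\alpha^j+(q-r)\beta^j\bigr)^{n-1}.$$
   Context: $B_n$ denotes the $n$-th Bernoulli number, defined by $\sum_{n\ge0}B_n\frac{z^n}{n!}=\frac{z}{e^z-1}$ (so $B_1=-1/2$). $F_n$ denotes the Fibonacci numbers: $F_0=0$, $F_1=1$, $F_n=F_{n-1}+F_{n-2}$. -}

module Defs where

open import Data.Nat as ℕ using (ℕ; zero; suc; _∸_)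
open import Data.Nat.Combinatorics using (_C_)
open import Data.Integer using (ℤ; +_)
open import Data.Rational as ℚ using (ℚ; 0ℚ; 1ℚ; _/_)
open import Data.Fin using (Fin; toℕ; fromℕ)
import Data.Fin as F
open import Data.Bool using (true; false)
open import Data.Vec using (Vec; []; _∷_; _∷ʳ_; lookup)

fib : ℕ → ℕ
fib zero = zero
fib (suc zero) = suc zero
fib (suc (suc n)) = fib (suc n) ℕ.+ fib n

ℕ→ℚ : ℕ → ℚ
ℕ→ℚ n = (+ n) / 1

-- reciprocal of a natural number (only used for q ≥ 2; 1/0 := 0 is a junk value)
recipℕ : ℕ → ℚ
recipℕ zero = 0ℚ
recipℕ (suc k) = (+ 1) / suc k

sumTo : ℕ → (ℕ → ℚ) → ℚ
sumTo zero f = f 0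
sumTo (suc n) f = sumTo n f ℚ.+ f (suc n)

-- Bernoulli numbers (B_1 = -1/2), via the recurrence equivalent to
-- z/(e^z-1) = Σ B_n z^n/n! :  B_0 = 1,  Σ_{k=0}^{N} C(N+1,k) B_k = 0 for N ≥ 1.
sumFin : (m : ℕ) → (Fin m → ℚ) → ℚ
sumFin zero f = 0ℚ
sumFin (suc m) f = f F.zero ℚ.+ sumFin m (λ i → f (F.suc i))

bernVec : (m : ℕ) → Vec ℚ (suc m)
bernVec zero = 1ℚ ∷ []
bernVec (suc m) = bs ∷ʳ next
  where
  bs = bernVec m
  next : ℚ
  next = ℚ.- (sumFin (suc m) (λ i → ℕ→ℚ ((suc (suc m)) C (toℕ i)) ℚ.* lookup bs i)
              ℚ.* ((+ 1) / suc (suc m)))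

bernoulli : ℕ → ℚ
bernoulli n = lookup (bernVec n) (fromℕ n)

-- The field ℚ(√5) ⊂ ℝ: a + b√5 represented as the pair (a , b)
record Q5 : Set where
  constructor _+√5·_
  field
    re : ℚ
    im : ℚ
open Q5 public

infixl 6 _⊕_ _⊖_
infixl 7 _⊗_
infixr 8 _^5_

_⊕_ : Q5 → Q5 → Q5
(a +√5· b) ⊕ (c +√5· d) = (a ℚ.+ c) +√5· (b ℚ.+ d)

_⊖_ : Q5 → Q5 → Q5
(a +√5· b) ⊖ (c +√5· d) = (a ℚ.- c) +√5· (b ℚ.- d)

_⊗_ : Q5 → Q5 → Q5
(a +√5· b) ⊗ (c +√5· d) =
  ((a ℚ.* c) ℚ.+ (ℕ→ℚ 5 ℚ.* (b ℚ.* d))) +√5· ((a ℚ.* d) ℚ.+ (b ℚ.* c))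

ι : ℚ → Q5
ι a = a +√5· 0ℚ

one5 : Q5
one5 = ι 1ℚ

_^5_ : Q5 → ℕ → Q5
x ^5 zero = one5
x ^5 suc n = x ⊗ (x ^5 n)

sum5 : ℕ → (ℕ → Q5) → Q5
sum5 zero f = f 0
sum5 (suc n) f = sum5 n f ⊕ f (suc n)

sumFromTo5 : ℕ → ℕ → (ℕ → Q5) → Q5
sumFromTo5 a b f with b ℕ.<ᵇ a
... | true = ι 0ℚ
... | false = sum5 (b ∸ a) (λ i → f (a ℕ.+ i))

nat5 : ℕ → Q5
nat5 n = ι (ℕ→ℚ n)

√5 : Q5
√5 = 0ℚ +√5· 1ℚ

α β : Q5
α = ((+ 1) / 2) +√5· ((+ 1) / 2)
β = ((+ 1) / 2) +√5· (ℚ.- ((+ 1) / 2))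

-- q^(1-m) for a natural q ≥ 2 and m ∈ ℕ, i.e. q · (1/q)^m
qPow1m : ℕ → ℕ → Q5
qPow1m q m = nat5 q ⊗ (ι (recipℕ q) ^5 m)

{-# OPTIONS --safe #-}

-- Put x = √5 F_j = α^j - β^j and let P_h (y) = h^n B_n (y / h) be the homogenised
-- Bernoulli polynomial.  Multiplied by √5, the left-hand side becomes
-- q (P_{x/q} (α^j) - P_{x/q} (β^j)) - (P_x (α^j) - P_x (β^j)).  Since α^j = β^j + x, the
-- difference equation P_h (y + h) - P_h (y) = n h y^(n-1) telescopes this into
-- n x ∑_{r=1}^{q-1} (β^j + r x / q)^(n-1), and r α^j + (q - r) β^j = q (β^j + r x / q)
-- identifies it with √5 times the right-hand side.  The difference equation is the
-- Bernoulli recurrence, read as an identity of binomial convolutions (products of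
-- exponential generating functions) of sequences in a commutative semiring.

module Submission where

open import Defs
open import Algebra.Bundles using (CommutativeSemiring; CommutativeRing)
import Algebra.Solver.Ring.AlmostCommutativeRing as ACR
import Algebra.Solver.Ring.Simple as SimpleSolver
open import Data.Nat as ℕ using (ℕ; zero; suc; _∸_; _≤_; z≤n)
import Data.Nat.Properties as ℕ
open import Data.Nat.Combinatorics
  using (_C_; nCk+nC[k+1]≡[n+1]C[k+1]; k>n⇒nCk≡0; nCn≡1; nCk≡nC[n∸k]; nC1≡n)
open import Data.Nat.Coprimality as Coprimality using ()
open import Data.Integer as ℤ using (+_)
import Data.Integer.Properties as ℤ
open import Data.Rational as ℚ using (ℚ; 0ℚ; 1ℚ; mkℚ)
import Data.Rational.Properties as ℚ
import Data.Rational.Unnormalised as ℚᵘ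
import Data.Rational.Unnormalised.Properties as ℚᵘ
open import Data.Rational.Solver renaming (module +-*-Solver to ℚ-Solver)
open import Data.Product using (_,_)
open import Data.Fin as Fin using (Fin; toℕ; inject₁; lower₁)
import Data.Fin.Properties as Fin
open import Data.Vec using (Vec; []; _∷_; _∷ʳ_; lookup)
open import Function.Base using (_∘_)
open import Relation.Binary.PropositionalEquality as ≡ using (_≡_)
open import Relation.Nullary using (Dec; yes; no)

module BinomialConvolution {a ℓ} (R : CommutativeSemiring a ℓ) where

  open CommutativeSemiring R
  open import Algebra.Properties.Semiring.Exp semiring using (_^_; ^-congˡ)
  open import Algebra.Properties.Monoid.Mult +-monoid using (_×_; ×-homo-+)
  open import Algebra.Solver.Ring.NaturalCoefficients.Default R
  open import Relation.Binary.Reasoning.Setoid setoid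
  open import Algebra.Properties.CommutativeSemigroup +-commutativeSemigroup using (interchange)
  open import Algebra.Properties.CommutativeSemigroup *-commutativeSemigroup using (x∙yz≈y∙xz)

  Seq : Set a
  Seq = ℕ → Carrier

  infix 4 _≐_
  _≐_ : Seq → Seq → Set ℓ
  u ≐ v = ∀ i → u i ≈ v i

  fromℕ : ℕ → Carrier
  fromℕ n = n × 1#

  ∑≤ : ℕ → Seq → Carrier
  ∑≤ zero    f = f 0
  ∑≤ (suc n) f = ∑≤ n f + f (suc n)

  ∑≤-cong : ∀ n {f g : Seq} → (∀ k → k ≤ n → f k ≈ g k) → ∑≤ n f ≈ ∑≤ n g
  ∑≤-cong zero    f≈g = f≈g 0 z≤n
  ∑≤-cong (suc n) f≈g =
    +-cong (∑≤-cong n (λ k k≤n → f≈g k (ℕ.m≤n⇒m≤1+n k≤n))) (f≈g (suc n) ℕ.≤-refl)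

  ∑≤-+ : ∀ n (f g : Seq) → ∑≤ n (λ k → f k + g k) ≈ ∑≤ n f + ∑≤ n g
  ∑≤-+ zero    f g = refl
  ∑≤-+ (suc n) f g = begin
    ∑≤ n (λ k → f k + g k) + (f (suc n) + g (suc n))
      ≈⟨ +-congʳ (∑≤-+ n f g) ⟩
    (∑≤ n f + ∑≤ n g) + (f (suc n) + g (suc n))
      ≈⟨ interchange _ _ _ _ ⟩
    (∑≤ n f + f (suc n)) + (∑≤ n g + g (suc n)) ∎

  ∑≤-*ˡ : ∀ n x (f : Seq) → ∑≤ n (λ k → x * f k) ≈ x * ∑≤ n f
  ∑≤-*ˡ zero    x f = refl
  ∑≤-*ˡ (suc n) x f = trans (+-congʳ (∑≤-*ˡ n x f)) (sym (distribˡ x (∑≤ n f) (f (suc n))))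

  ∑≤-shift : ∀ n (f : Seq) → ∑≤ (suc n) f ≈ f 0 + ∑≤ n (f ∘ suc)
  ∑≤-shift zero    f = refl
  ∑≤-shift (suc n) f = trans (+-congʳ (∑≤-shift n f)) (+-assoc (f 0) _ _)

  -- (u ⋆ v) n = ∑ₖ C(n,k) u (n - k) v k: the product of exponential generating functions.
  infixl 7 _⋆_
  _⋆_ : Seq → Seq → Seq
  (u ⋆ v) zero    = u 0 * v 0
  (u ⋆ v) (suc n) = ((u ∘ suc) ⋆ v) n + (u ⋆ (v ∘ suc)) n

  ⋆-cong : ∀ {u u′ v v′} → u ≐ u′ → v ≐ v′ → u ⋆ v ≐ u′ ⋆ v′
  ⋆-cong u≐u′ v≐v′ zero    = *-cong (u≐u′ 0) (v≐v′ 0)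
  ⋆-cong u≐u′ v≐v′ (suc n) =
    +-cong (⋆-cong (u≐u′ ∘ suc) v≐v′ n) (⋆-cong u≐u′ (v≐v′ ∘ suc) n)

  ⋆-congˡ : ∀ {u u′} v → u ≐ u′ → u ⋆ v ≐ u′ ⋆ v
  ⋆-congˡ v u≐u′ = ⋆-cong u≐u′ (λ _ → refl)

  ⋆-congʳ : ∀ u {v v′} → v ≐ v′ → u ⋆ v ≐ u ⋆ v′
  ⋆-congʳ u v≐v′ = ⋆-cong (λ _ → refl) v≐v′

  ⋆-comm : ∀ u v → u ⋆ v ≐ v ⋆ u
  ⋆-comm u v zero    = *-comm (u 0) (v 0)
  ⋆-comm u v (suc n) =
    trans (+-cong (⋆-comm (u ∘ suc) v n) (⋆-comm u (v ∘ suc) n)) (+-comm _ _)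

  ⋆-distribˡ : ∀ u v w → u ⋆ (λ i → v i + w i) ≐ λ n → (u ⋆ v) n + (u ⋆ w) n
  ⋆-distribˡ u v w zero    = distribˡ (u 0) (v 0) (w 0)
  ⋆-distribˡ u v w (suc n) = begin
    ((u ∘ suc) ⋆ (λ i → v i + w i)) n + (u ⋆ (λ i → v (suc i) + w (suc i))) n
      ≈⟨ +-cong (⋆-distribˡ (u ∘ suc) v w n) (⋆-distribˡ u (v ∘ suc) (w ∘ suc) n) ⟩
    (((u ∘ suc) ⋆ v) n + ((u ∘ suc) ⋆ w) n) + ((u ⋆ (v ∘ suc)) n + (u ⋆ (w ∘ suc)) n)
      ≈⟨ interchange _ _ _ _ ⟩
    (u ⋆ v) (suc n) + (u ⋆ w) (suc n) ∎

  ⋆-distribʳ : ∀ u v w → (λ i → u i + v i) ⋆ w ≐ λ n → (u ⋆ w) n + (v ⋆ w) n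
  ⋆-distribʳ u v w n = begin
    ((λ i → u i + v i) ⋆ w) n   ≈⟨ ⋆-comm _ w n ⟩
    (w ⋆ (λ i → u i + v i)) n   ≈⟨ ⋆-distribˡ w u v n ⟩
    (w ⋆ u) n + (w ⋆ v) n       ≈⟨ +-cong (⋆-comm w u n) (⋆-comm w v n) ⟩
    (u ⋆ w) n + (v ⋆ w) n       ∎

  ⋆-*ʳ : ∀ x u v → u ⋆ (λ i → x * v i) ≐ λ n → x * (u ⋆ v) n
  ⋆-*ʳ x u v zero    = solve 3 (λ a b x → a :* (x :* b) := x :* (a :* b)) refl (u 0) (v 0) x
  ⋆-*ʳ x u v (suc n) =
    trans (+-cong (⋆-*ʳ x (u ∘ suc) v n) (⋆-*ʳ x u (v ∘ suc) n)) (sym (distribˡ x _ _))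

  ⋆-*ˡ : ∀ x u v → (λ i → x * u i) ⋆ v ≐ λ n → x * (u ⋆ v) n
  ⋆-*ˡ x u v n = trans (⋆-comm _ v n) (trans (⋆-*ʳ x v u n) (*-congˡ (⋆-comm v u n)))

  ⋆-assoc : ∀ u v w → (u ⋆ v) ⋆ w ≐ u ⋆ (v ⋆ w)
  ⋆-assoc u v w zero    = *-assoc (u 0) (v 0) (w 0)
  ⋆-assoc u v w (suc n) = begin
    (((u ⋆ v) ∘ suc) ⋆ w) n + ((u ⋆ v) ⋆ (w ∘ suc)) n
      ≈⟨ +-congʳ (⋆-distribʳ ((u ∘ suc) ⋆ v) (u ⋆ (v ∘ suc)) w n) ⟩
    ((((u ∘ suc) ⋆ v) ⋆ w) n + ((u ⋆ (v ∘ suc)) ⋆ w) n) + ((u ⋆ v) ⋆ (w ∘ suc)) n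
      ≈⟨ +-cong (+-cong (⋆-assoc (u ∘ suc) v w n) (⋆-assoc u (v ∘ suc) w n))
                (⋆-assoc u v (w ∘ suc) n) ⟩
    (((u ∘ suc) ⋆ (v ⋆ w)) n + (u ⋆ ((v ∘ suc) ⋆ w)) n) + (u ⋆ (v ⋆ (w ∘ suc))) n
      ≈⟨ +-assoc _ _ _ ⟩
    ((u ∘ suc) ⋆ (v ⋆ w)) n + ((u ⋆ ((v ∘ suc) ⋆ w)) n + (u ⋆ (v ⋆ (w ∘ suc))) n)
      ≈⟨ +-congˡ (sym (⋆-distribˡ u ((v ∘ suc) ⋆ w) (v ⋆ (w ∘ suc)) n)) ⟩
    (u ⋆ (v ⋆ w)) (suc n) ∎

  ⋆-twist : ∀ h u v → (λ i → u i * h ^ i) ⋆ (λ i → v i * h ^ i) ≐ λ n → h ^ n * (u ⋆ v) n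
  ⋆-twist h u v zero    = solve 2 (λ a b → (a :* con 1) :* (b :* con 1) := con 1 :* (a :* b)) refl (u 0) (v 0)
  ⋆-twist h u v (suc n) = begin
    (U ∘ suc ⋆ V) n + (U ⋆ V ∘ suc) n
      ≈⟨ +-cong (⋆-congˡ V (λ i → pull h (u (suc i)) (h ^ i)) n)
                (⋆-congʳ U (λ i → pull h (v (suc i)) (h ^ i)) n) ⟩
    ((λ i → h * (u (suc i) * h ^ i)) ⋆ V) n + (U ⋆ (λ i → h * (v (suc i) * h ^ i))) n
      ≈⟨ +-cong (⋆-*ˡ h _ V n) (⋆-*ʳ h U _ n) ⟩
    h * ((λ i → u (suc i) * h ^ i) ⋆ V) n + h * (U ⋆ (λ i → v (suc i) * h ^ i)) n
      ≈⟨ +-cong (*-congˡ (⋆-twist h (u ∘ suc) v n)) (*-congˡ (⋆-twist h u (v ∘ suc) n)) ⟩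
    h * (h ^ n * ((u ∘ suc) ⋆ v) n) + h * (h ^ n * (u ⋆ (v ∘ suc)) n)
      ≈⟨ solve 4 (λ h p a b → h :* (p :* a) :+ h :* (p :* b) := (h :* p) :* (a :+ b)) refl h (h ^ n) _ _ ⟩
    h ^ suc n * (u ⋆ v) (suc n) ∎
    where
    U V : Seq
    U i = u i * h ^ i
    V i = v i * h ^ i
    pull : ∀ h a p → a * (h * p) ≈ h * (a * p)
    pull = solve 3 (λ h a p → a :* (h :* p) := h :* (a :* p)) refl

  ⋆-binomial : ∀ x y → (x ^_) ⋆ (y ^_) ≐ (x + y) ^_
  ⋆-binomial x y zero    = *-identityˡ 1#
  ⋆-binomial x y (suc n) = begin
    ((λ i → x * x ^ i) ⋆ (y ^_)) n + ((x ^_) ⋆ (λ i → y * y ^ i)) n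
      ≈⟨ +-cong (⋆-*ˡ x (x ^_) (y ^_) n) (⋆-*ʳ y (x ^_) (y ^_) n) ⟩
    x * ((x ^_) ⋆ (y ^_)) n + y * ((x ^_) ⋆ (y ^_)) n
      ≈⟨ sym (distribʳ _ x y) ⟩
    (x + y) * ((x ^_) ⋆ (y ^_)) n
      ≈⟨ *-congˡ (⋆-binomial x y n) ⟩
    (x + y) ^ suc n ∎

  𝟙 δ₀ δ₁ : Seq
  𝟙 _ = 1#
  δ₀ zero    = 1#
  δ₀ (suc _) = 0#
  δ₁ zero    = 0#
  δ₁ (suc i) = δ₀ i

  0#-⋆ : ∀ w → (λ _ → 0#) ⋆ w ≐ λ _ → 0#
  0#-⋆ w zero    = zeroˡ (w 0)
  0#-⋆ w (suc n) = trans (+-cong (0#-⋆ w n) (0#-⋆ (w ∘ suc) n)) (+-identityˡ 0#)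

  δ₀-⋆ : ∀ w → δ₀ ⋆ w ≐ w
  δ₀-⋆ w zero    = *-identityˡ (w 0)
  δ₀-⋆ w (suc n) = trans (+-cong (0#-⋆ w n) (δ₀-⋆ (w ∘ suc) n)) (+-identityˡ (w (suc n)))

  δ₁-⋆ : ∀ w m → (δ₁ ⋆ w) (suc m) ≈ fromℕ (suc m) * w m
  δ₁-⋆ w zero    = solve 2 (λ a b → con 1 :* a :+ con 0 :* b := (con 1 :+ con 0) :* a) refl (w 0) (w 1)
  δ₁-⋆ w (suc m) = begin
    (δ₀ ⋆ w) (suc m) + (δ₁ ⋆ w ∘ suc) (suc m)  ≈⟨ +-cong (δ₀-⋆ w (suc m)) (δ₁-⋆ (w ∘ suc) m) ⟩
    w (suc m) + fromℕ (suc m) * w (suc m)    ≈⟨ solve 2 (λ a n → a :+ n :* a := (con 1 :+ n) :* a) refl _ _ ⟩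
    fromℕ (suc (suc m)) * w (suc m)          ∎

  fromℕ-pascal : ∀ n k → fromℕ (suc n C suc k) ≈ fromℕ (n C k) + fromℕ (n C suc k)
  fromℕ-pascal n k = trans (reflexive (≡.cong fromℕ (≡.sym (nCk+nC[k+1]≡[n+1]C[k+1] n k))))
                           (×-homo-+ 1# (n C k) (n C suc k))

  ⋆-binomialSum : ∀ u v n → (u ⋆ v) n ≈ ∑≤ n (λ k → fromℕ (n C k) * (u (n ∸ k) * v k))
  ⋆-binomialSum u v zero    = solve 2 (λ a b → a :* b := (con 1 :+ con 0) :* (a :* b)) refl (u 0) (v 0)
  ⋆-binomialSum u v (suc n) = begin
    ((u ∘ suc) ⋆ v) n + (u ⋆ (v ∘ suc)) n
      ≈⟨ +-cong (⋆-binomialSum (u ∘ suc) v n) (⋆-binomialSum u (v ∘ suc) n) ⟩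
    ∑≤ n (λ k → fromℕ (n C k) * (u (suc (n ∸ k)) * v k)) + ∑≤ n t
      ≈⟨ +-congʳ (∑≤-cong n (λ k k≤n → reflexive
           (≡.cong (λ m → fromℕ (n C k) * (u m * v k)) (≡.sym (ℕ.+-∸-assoc 1 k≤n))))) ⟩
    ∑≤ n g + ∑≤ n t
      ≈⟨ +-congʳ (trans (sym (+-identityʳ _)) (+-congˡ (sym g-last))) ⟩
    ∑≤ (suc n) g + ∑≤ n t
      ≈⟨ +-congʳ (∑≤-shift n g) ⟩
    (g 0 + ∑≤ n (g ∘ suc)) + ∑≤ n t
      ≈⟨ +-assoc _ _ _ ⟩
    g 0 + (∑≤ n (g ∘ suc) + ∑≤ n t)
      ≈⟨ +-congˡ (sym (∑≤-+ n _ _)) ⟩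
    g 0 + ∑≤ n (λ k → g (suc k) + t k)
      ≈⟨ +-congˡ (∑≤-cong n (λ k _ → pascal k)) ⟩
    s 0 + ∑≤ n (s ∘ suc)
      ≈⟨ sym (∑≤-shift n s) ⟩
    ∑≤ (suc n) s ∎
    where
    s g t : Seq
    s k = fromℕ (suc n C k) * (u (suc n ∸ k) * v k)
    g k = fromℕ (n C k) * (u (suc n ∸ k) * v k)
    t k = fromℕ (n C k) * (u (n ∸ k) * v (suc k))
    g-last : g (suc n) ≈ 0#
    g-last = trans (reflexive (≡.cong (λ c → fromℕ c * (u (n ∸ n) * v (suc n))) (k>n⇒nCk≡0 (ℕ.n<1+n n))))
                   (zeroˡ _)
    pascal : ∀ k → g (suc k) + t k ≈ s (suc k)
    pascal k = trans (sym (distribʳ _ (fromℕ (n C suc k)) (fromℕ (n C k))))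
                     (*-congʳ (trans (+-comm _ _) (sym (fromℕ-pascal n k))))

  -- homBernoulli B h y n = h ^ n * B_n (y / h), where B_n (y) = ∑ₖ C(n,k) B k y ^ (n - k).
  homBernoulli : Seq → Carrier → Carrier → Seq
  homBernoulli B h y = (λ i → B i * h ^ i) ⋆ (y ^_)

  homBernoulli-congʳ : ∀ B h {y y′} → y ≈ y′ → homBernoulli B h y ≐ homBernoulli B h y′
  homBernoulli-congʳ B h y≈y′ = ⋆-congʳ _ (λ i → ^-congˡ i y≈y′)

  ^-*-δ₁ : ∀ h i → h ^ i * δ₁ i ≈ h * δ₁ i
  ^-*-δ₁ h zero          = trans (zeroʳ 1#) (sym (zeroʳ h))
  ^-*-δ₁ h (suc zero)    = *-congʳ (*-identityʳ h)
  ^-*-δ₁ h (suc (suc i)) = trans (zeroʳ _) (sym (zeroʳ h))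

  -- B ⋆ 𝟙 ≐ B + δ₁ is the recurrence of the Bernoulli numbers, B_n (1) = B_n (0) + [n = 1].
  module _ {B : Seq} (B⋆𝟙 : B ⋆ 𝟙 ≐ λ n → B n + δ₁ n) where

    private
      Bʰ⋆powers : ∀ h → (λ i → B i * h ^ i) ⋆ (h ^_) ≐ λ i → B i * h ^ i + h * δ₁ i
      Bʰ⋆powers h N = begin
        ((λ i → B i * h ^ i) ⋆ (h ^_)) N
          ≈⟨ ⋆-congʳ _ (λ i → sym (*-identityˡ (h ^ i))) N ⟩
        ((λ i → B i * h ^ i) ⋆ (λ i → 𝟙 i * h ^ i)) N
          ≈⟨ ⋆-twist h B 𝟙 N ⟩
        h ^ N * (B ⋆ 𝟙) N
          ≈⟨ *-congˡ (B⋆𝟙 N) ⟩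
        h ^ N * (B N + δ₁ N)
          ≈⟨ solve 3 (λ p b d → p :* (b :+ d) := b :* p :+ p :* d) refl (h ^ N) (B N) (δ₁ N) ⟩
        B N * h ^ N + h ^ N * δ₁ N
          ≈⟨ +-congˡ (^-*-δ₁ h N) ⟩
        B N * h ^ N + h * δ₁ N ∎

    homBernoulli-step : ∀ h y m →
      homBernoulli B h (y + h) (suc m) ≈ homBernoulli B h y (suc m) + fromℕ (suc m) * (h * y ^ m)
    homBernoulli-step h y m = begin
      (Bʰ ⋆ ((y + h) ^_)) n
        ≈⟨ ⋆-congʳ Bʰ (λ i → sym (trans (⋆-binomial h y i) (^-congˡ i (+-comm h y)))) n ⟩
      (Bʰ ⋆ ((h ^_) ⋆ (y ^_))) n
        ≈⟨ sym (⋆-assoc Bʰ (h ^_) (y ^_) n) ⟩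
      ((Bʰ ⋆ (h ^_)) ⋆ (y ^_)) n
        ≈⟨ ⋆-congˡ (y ^_) (Bʰ⋆powers h) n ⟩
      ((λ i → Bʰ i + h * δ₁ i) ⋆ (y ^_)) n
        ≈⟨ ⋆-distribʳ Bʰ (λ i → h * δ₁ i) (y ^_) n ⟩
      (Bʰ ⋆ (y ^_)) n + ((λ i → h * δ₁ i) ⋆ (y ^_)) n
        ≈⟨ +-congˡ (trans (⋆-*ˡ h δ₁ (y ^_) n) (*-congˡ (δ₁-⋆ (y ^_) m))) ⟩
      (Bʰ ⋆ (y ^_)) n + h * (fromℕ n * y ^ m)
        ≈⟨ +-congˡ (x∙yz≈y∙xz h (fromℕ n) (y ^ m)) ⟩
      homBernoulli B h y n + fromℕ n * (h * y ^ m) ∎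
      where
      n = suc m
      Bʰ : Seq
      Bʰ i = B i * h ^ i

    homBernoulli-telescope : ∀ h y k m →
      homBernoulli B h (y + fromℕ (suc m) * h) (suc k)
        ≈ homBernoulli B h y (suc k) + fromℕ (suc k) * (h * ∑≤ m (λ i → (y + fromℕ i * h) ^ k))
    homBernoulli-telescope h y k zero = begin
      homBernoulli B h (y + fromℕ 1 * h) (suc k)
        ≈⟨ homBernoulli-congʳ B h (solve 2 (λ y h → y :+ (con 1 :+ con 0) :* h := y :+ h) refl y h) (suc k) ⟩
      homBernoulli B h (y + h) (suc k)
        ≈⟨ homBernoulli-step h y k ⟩
      homBernoulli B h y (suc k) + fromℕ (suc k) * (h * y ^ k)
        ≈⟨ +-congˡ (*-congˡ (*-congˡ (^-congˡ k (solve 2 (λ y h → y := y :+ con 0 :* h) refl y h)))) ⟩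
      homBernoulli B h y (suc k) + fromℕ (suc k) * (h * (y + fromℕ 0 * h) ^ k) ∎
    homBernoulli-telescope h y k (suc m) = begin
      homBernoulli B h (y + fromℕ (suc (suc m)) * h) (suc k)
        ≈⟨ homBernoulli-congʳ B h (solve 3 (λ y c h → y :+ (con 1 :+ c) :* h := (y :+ c :* h) :+ h)
                                          refl y (fromℕ (suc m)) h) (suc k) ⟩
      homBernoulli B h (y′ + h) (suc k)
        ≈⟨ homBernoulli-step h y′ k ⟩
      homBernoulli B h y′ (suc k) + c * (h * y′ ^ k)
        ≈⟨ +-congʳ (homBernoulli-telescope h y k m) ⟩
      (homBernoulli B h y (suc k) + c * (h * S)) + c * (h * y′ ^ k)
        ≈⟨ solve 5 (λ P c h S t → (P :+ c :* (h :* S)) :+ c :* (h :* t) := P :+ c :* (h :* (S :+ t)))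
                   refl _ c h S (y′ ^ k) ⟩
      homBernoulli B h y (suc k) + c * (h * ∑≤ (suc m) (λ i → (y + fromℕ i * h) ^ k)) ∎
      where
      y′ = y + fromℕ (suc m) * h
      c = fromℕ (suc k)
      S = ∑≤ m (λ i → (y + fromℕ i * h) ^ k)

open import Data.Nat using (_*_)
open ≡ using (refl; sym; trans; cong; cong₂; isEquivalence; module ≡-Reasoning)

-- The field ℚ(√5)

+√5·-cong : ∀ {a b c d} → a ≡ c → b ≡ d → (a +√5· b) ≡ (c +√5· d)
+√5·-cong refl refl = refl

zero5 : Q5
zero5 = ι 0ℚ

neg5 : Q5 → Q5
neg5 (a +√5· b) = (ℚ.- a) +√5· (ℚ.- b)

⊕-comm : ∀ x y → x ⊕ y ≡ y ⊕ x
⊕-comm (a +√5· b) (c +√5· d) = +√5·-cong (ℚ.+-comm a c) (ℚ.+-comm b d)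

⊕-assoc : ∀ x y z → (x ⊕ y) ⊕ z ≡ x ⊕ (y ⊕ z)
⊕-assoc (a +√5· b) (c +√5· d) (e +√5· f) = +√5·-cong (ℚ.+-assoc a c e) (ℚ.+-assoc b d f)

⊕-identityˡ : ∀ x → zero5 ⊕ x ≡ x
⊕-identityˡ (a +√5· b) = +√5·-cong (ℚ.+-identityˡ a) (ℚ.+-identityˡ b)

⊕-identityʳ : ∀ x → x ⊕ zero5 ≡ x
⊕-identityʳ (a +√5· b) = +√5·-cong (ℚ.+-identityʳ a) (ℚ.+-identityʳ b)

neg5-inverseˡ : ∀ x → neg5 x ⊕ x ≡ zero5
neg5-inverseˡ (a +√5· b) = +√5·-cong (ℚ.+-inverseˡ a) (ℚ.+-inverseˡ b)

neg5-inverseʳ : ∀ x → x ⊕ neg5 x ≡ zero5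
neg5-inverseʳ (a +√5· b) = +√5·-cong (ℚ.+-inverseʳ a) (ℚ.+-inverseʳ b)

⊗-comm : ∀ x y → x ⊗ y ≡ y ⊗ x
⊗-comm (a +√5· b) (c +√5· d) = +√5·-cong
  (solve 5 (λ a b c d k → a :* c :+ k :* (b :* d) := c :* a :+ k :* (d :* b)) refl a b c d (ℕ→ℚ 5))
  (solve 4 (λ a b c d → a :* d :+ b :* c := c :* b :+ d :* a) refl a b c d)
  where open ℚ-Solver

⊗-assoc : ∀ x y z → (x ⊗ y) ⊗ z ≡ x ⊗ (y ⊗ z)
⊗-assoc (a +√5· b) (c +√5· d) (e +√5· f) = +√5·-cong
  (solve 7 (λ a b c d e f k →
      (a :* c :+ k :* (b :* d)) :* e :+ k :* ((a :* d :+ b :* c) :* f)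
   := a :* (c :* e :+ k :* (d :* f)) :+ k :* (b :* (c :* f :+ d :* e))) refl a b c d e f (ℕ→ℚ 5))
  (solve 7 (λ a b c d e f k →
      (a :* c :+ k :* (b :* d)) :* f :+ (a :* d :+ b :* c) :* e
   := a :* (c :* f :+ d :* e) :+ b :* (c :* e :+ k :* (d :* f))) refl a b c d e f (ℕ→ℚ 5))
  where open ℚ-Solver

⊗-identityˡ : ∀ x → one5 ⊗ x ≡ x
⊗-identityˡ (a +√5· b) = +√5·-cong
  (solve 3 (λ a b k → con 1ℚ :* a :+ k :* (con 0ℚ :* b) := a) refl a b (ℕ→ℚ 5))
  (solve 2 (λ a b → con 1ℚ :* b :+ con 0ℚ :* a := b) refl a b)
  where open ℚ-Solver

⊗-identityʳ : ∀ x → x ⊗ one5 ≡ x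
⊗-identityʳ x = trans (⊗-comm x one5) (⊗-identityˡ x)

⊗-distribˡ-⊕ : ∀ x y z → x ⊗ (y ⊕ z) ≡ x ⊗ y ⊕ x ⊗ z
⊗-distribˡ-⊕ (a +√5· b) (c +√5· d) (e +√5· f) = +√5·-cong
  (solve 7 (λ a b c d e f k → a :* (c :+ e) :+ k :* (b :* (d :+ f))
      := (a :* c :+ k :* (b :* d)) :+ (a :* e :+ k :* (b :* f))) refl a b c d e f (ℕ→ℚ 5))
  (solve 6 (λ a b c d e f → a :* (d :+ f) :+ b :* (c :+ e)
      := (a :* d :+ b :* c) :+ (a :* f :+ b :* e)) refl a b c d e f)
  where open ℚ-Solver

⊗-distribʳ-⊕ : ∀ x y z → (y ⊕ z) ⊗ x ≡ y ⊗ x ⊕ z ⊗ x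
⊗-distribʳ-⊕ x y z = trans (⊗-comm (y ⊕ z) x)
  (trans (⊗-distribˡ-⊕ x y z) (cong₂ _⊕_ (⊗-comm x y) (⊗-comm x z)))

_≟5_ : (x y : Q5) → Dec (x ≡ y)
(a +√5· b) ≟5 (c +√5· d) with a ℚ.≟ c | b ℚ.≟ d
... | yes refl | yes refl = yes refl
... | no a≢c   | _        = no λ { refl → a≢c refl }
... | yes _    | no b≢d   = no λ { refl → b≢d refl }

Q5-commutativeRing : CommutativeRing _ _
Q5-commutativeRing = record
  { _≈_ = _≡_ ; _+_ = _⊕_ ; _*_ = _⊗_ ; -_ = neg5 ; 0# = zero5 ; 1# = one5
  ; isCommutativeRing = record
    { isRing = record
      { +-isAbelianGroup = record
        { isGroup = record
          { isMonoid = record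
            { isSemigroup = record
              { isMagma = record { isEquivalence = isEquivalence ; ∙-cong = cong₂ _⊕_ }
              ; assoc = ⊕-assoc }
            ; identity = ⊕-identityˡ , ⊕-identityʳ }
          ; inverse = neg5-inverseˡ , neg5-inverseʳ
          ; ⁻¹-cong = cong neg5 }
        ; comm = ⊕-comm }
      ; *-cong = cong₂ _⊗_
      ; *-assoc = ⊗-assoc
      ; *-identity = ⊗-identityˡ , ⊗-identityʳ
      ; distrib = ⊗-distribˡ-⊕ , ⊗-distribʳ-⊕ }
    ; *-comm = ⊗-comm } }

module Q5-Solver = SimpleSolver (ACR.fromCommutativeRing Q5-commutativeRing) _≟5_

open CommutativeRing Q5-commutativeRing using (semiring; commutativeSemiring; +-monoid)
open BinomialConvolution commutativeSemiring
open import Algebra.Properties.Semiring.Exp semiring using (_^_; ^-assocʳ)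
open import Algebra.Properties.CommutativeSemiring.Exp commutativeSemiring using (^-distrib-*)
open import Algebra.Properties.Monoid.Mult +-monoid using (×-homo-+)

^≡^5 : ∀ x n → x ^ n ≡ x ^5 n
^≡^5 x zero    = refl
^≡^5 x (suc n) = cong (x ⊗_) (^≡^5 x n)

∑≤≡sum5 : ∀ n f → ∑≤ n f ≡ sum5 n f
∑≤≡sum5 zero    f = refl
∑≤≡sum5 (suc n) f = cong (_⊕ f (suc n)) (∑≤≡sum5 n f)

∑≤-⊖ : ∀ n f g → ∑≤ n (λ i → f i ⊖ g i) ≡ ∑≤ n f ⊖ ∑≤ n g
∑≤-⊖ zero    f g = refl
∑≤-⊖ (suc n) f g = trans (cong (_⊕ (f (suc n) ⊖ g (suc n))) (∑≤-⊖ n f g))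
  (Q5-Solver.solve 4 (λ a b c d → (a :- b) :+ (c :- d) := (a :+ c) :- (b :+ d))
                     refl (∑≤ n f) (∑≤ n g) (f (suc n)) (g (suc n)))
  where open Q5-Solver using (_:+_; _:-_; _:=_)

⊕-⊖-cancelˡ : ∀ y d → (y ⊕ d) ⊖ y ≡ d
⊕-⊖-cancelˡ = Q5-Solver.solve 2 (λ y d → (y :+ d) :- y := d) refl
  where open Q5-Solver using (_:+_; _:-_; _:=_)

one5-^ : ∀ m → one5 ^ m ≡ one5
one5-^ zero    = refl
one5-^ (suc m) = trans (⊗-identityˡ (one5 ^ m)) (one5-^ m)

ℕ→ℚ≡mkℚ : ∀ n → ℕ→ℚ n ≡ mkℚ (+ n) 0 (Coprimality.sym (Coprimality.1-coprimeTo n))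
ℕ→ℚ≡mkℚ n = ℚ.normalize-coprime (Coprimality.sym (Coprimality.1-coprimeTo n))

ℕ→ℚ-suc : ∀ n → ℕ→ℚ (suc n) ≡ 1ℚ ℚ.+ ℕ→ℚ n
ℕ→ℚ-suc n rewrite ℕ→ℚ≡mkℚ n | ℕ→ℚ≡mkℚ (suc n) =
  ℚ.toℚᵘ-injective (ℚᵘ.≃-trans (ℚᵘ.*≡* (1+m (+ n)))
    (ℚᵘ.≃-sym (ℚ.toℚᵘ-homo-+ 1ℚ (mkℚ (+ n) 0 (Coprimality.sym (Coprimality.1-coprimeTo n))))))
  where
  1+m : ∀ m → (+ 1 ℤ.+ m) ℤ.* (+ 1 ℤ.* + 1) ≡ (+ 1 ℤ.* + 1 ℤ.+ m ℤ.* + 1) ℤ.* + 1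
  1+m m = cong (λ t → (+ 1 ℤ.+ t) ℤ.* + 1) (sym (ℤ.*-identityʳ m))

nat5≡fromℕ : ∀ n → nat5 n ≡ fromℕ n
nat5≡fromℕ zero    = refl
nat5≡fromℕ (suc n) = trans (cong ι (ℕ→ℚ-suc n)) (cong (one5 ⊕_) (nat5≡fromℕ n))

nat5-+ : ∀ m n → nat5 (m ℕ.+ n) ≡ nat5 m ⊕ nat5 n
nat5-+ m n = begin
  nat5 (m ℕ.+ n)         ≡⟨ nat5≡fromℕ (m ℕ.+ n) ⟩
  fromℕ (m ℕ.+ n)        ≡⟨ ×-homo-+ one5 m n ⟩
  fromℕ m ⊕ fromℕ n      ≡⟨ sym (cong₂ _⊕_ (nat5≡fromℕ m) (nat5≡fromℕ n)) ⟩
  nat5 m ⊕ nat5 n        ∎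
  where open ≡-Reasoning

ι-⊗ : ∀ a b → ι (a ℚ.* b) ≡ ι a ⊗ ι b
ι-⊗ a b = +√5·-cong
  (sym (solve 3 (λ a b k → a :* b :+ k :* (con 0ℚ :* con 0ℚ) := a :* b) refl a b (ℕ→ℚ 5)))
  (sym (solve 2 (λ a b → a :* con 0ℚ :+ con 0ℚ :* b := con 0ℚ) refl a b))
  where open ℚ-Solver

ℕ→ℚ-*-recipℕ : ∀ k → ℕ→ℚ (suc k) ℚ.* recipℕ (suc k) ≡ 1ℚ
ℕ→ℚ-*-recipℕ k rewrite ℕ→ℚ≡mkℚ (suc k) | ℚ.normalize-coprime {1} {k} (Coprimality.1-coprimeTo (suc k)) =
  ℚ.*-inverseʳ (mkℚ (+ suc k) 0 (Coprimality.sym (Coprimality.1-coprimeTo (suc k))))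

nat5-*-recip : ∀ k → nat5 (suc k) ⊗ ι (recipℕ (suc k)) ≡ one5
nat5-*-recip k = trans (sym (ι-⊗ (ℕ→ℚ (suc k)) (recipℕ (suc k)))) (cong ι (ℕ→ℚ-*-recipℕ k))

binet : ∀ m → √5 ⊗ nat5 (fib m) ≡ α ^ m ⊖ β ^ m
binet zero          = refl
binet (suc zero)    = refl
binet (suc (suc m)) = begin
  √5 ⊗ nat5 (fib (suc m) ℕ.+ fib m)
    ≡⟨ cong (√5 ⊗_) (nat5-+ (fib (suc m)) (fib m)) ⟩
  √5 ⊗ (nat5 (fib (suc m)) ⊕ nat5 (fib m))
    ≡⟨ ⊗-distribˡ-⊕ √5 (nat5 (fib (suc m))) (nat5 (fib m)) ⟩
  √5 ⊗ nat5 (fib (suc m)) ⊕ √5 ⊗ nat5 (fib m)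
    ≡⟨ cong₂ _⊕_ (binet (suc m)) (binet m) ⟩
  (α ⊗ α ^ m ⊖ β ⊗ β ^ m) ⊕ (α ^ m ⊖ β ^ m)
    ≡⟨ Q5-Solver.solve 4 (λ a b A B → (a :* A :- b :* B) :+ (A :- B)
                                   := (a :+ con one5) :* A :- (b :+ con one5) :* B)
                         refl α β (α ^ m) (β ^ m) ⟩
  (α ⊕ one5) ⊗ α ^ m ⊖ (β ⊕ one5) ⊗ β ^ m
    ≡⟨ cong₂ _⊖_ (⊗-assoc α α (α ^ m)) (⊗-assoc β β (β ^ m)) ⟩
  α ^ suc (suc m) ⊖ β ^ suc (suc m) ∎
  where
  open ≡-Reasoning
  open Q5-Solver using (_:+_; _:*_; _:-_; _:=_; con)

-- (√5 / 5) ⊗ √5 computes to one5.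
√5-cancel : ∀ {u v} → √5 ⊗ u ≡ √5 ⊗ v → u ≡ v
√5-cancel {u} {v} √5u≡√5v = begin
  u                          ≡⟨ sym (⊗-identityˡ u) ⟩
  (√5/5 ⊗ √5) ⊗ u            ≡⟨ ⊗-assoc √5/5 √5 u ⟩
  √5/5 ⊗ (√5 ⊗ u)            ≡⟨ cong (√5/5 ⊗_) √5u≡√5v ⟩
  √5/5 ⊗ (√5 ⊗ v)            ≡⟨ sym (⊗-assoc √5/5 √5 v) ⟩
  (√5/5 ⊗ √5) ⊗ v            ≡⟨ ⊗-identityˡ v ⟩
  v                          ∎
  where
  open ≡-Reasoning
  √5/5 = ι (recipℕ 5) ⊗ √5

-- Bernoulli numbers

lookup-∷ʳ-inject₁ : ∀ {A : Set} {n} (xs : Vec A n) x (i : Fin n) → lookup (xs ∷ʳ x) (inject₁ i) ≡ lookup xs i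
lookup-∷ʳ-inject₁ (y ∷ xs) x Fin.zero    = refl
lookup-∷ʳ-inject₁ (y ∷ xs) x (Fin.suc i) = lookup-∷ʳ-inject₁ xs x i

lookup-∷ʳ-fromℕ : ∀ {A : Set} {n} (xs : Vec A n) x → lookup (xs ∷ʳ x) (Fin.fromℕ n) ≡ x
lookup-∷ʳ-fromℕ []       x = refl
lookup-∷ʳ-fromℕ (y ∷ xs) x = lookup-∷ʳ-fromℕ xs x

lookup-bernVec : ∀ m (i : Fin (suc m)) → lookup (bernVec m) i ≡ bernoulli (toℕ i)
lookup-bernVec zero    Fin.zero = refl
lookup-bernVec (suc m) i with suc m ℕ.≟ toℕ i
... | yes m+1≡i
  rewrite Fin.toℕ-injective {i = i} {j = Fin.fromℕ (suc m)}
                            (trans (sym m+1≡i) (sym (Fin.toℕ-fromℕ (suc m)))) =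
  cong bernoulli (sym (Fin.toℕ-fromℕ (suc m)))
... | no m+1≢i = begin
  lookup (bernVec (suc m)) i          ≡⟨ cong (lookup (bernVec (suc m))) (sym (Fin.inject₁-lower₁ i m+1≢i)) ⟩
  lookup (bernVec (suc m)) (inject₁ i′) ≡⟨ lookup-∷ʳ-inject₁ (bernVec m) _ i′ ⟩
  lookup (bernVec m) i′                ≡⟨ lookup-bernVec m i′ ⟩
  bernoulli (toℕ i′)                   ≡⟨ cong bernoulli (Fin.toℕ-lower₁ i m+1≢i) ⟩
  bernoulli (toℕ i)                       ∎
  where
  open ≡-Reasoning
  i′ = lower₁ i m+1≢i

sumFin-cong : ∀ n {f g : Fin n → ℚ} → (∀ i → f i ≡ g i) → sumFin n f ≡ sumFin n g
sumFin-cong zero    f≡g = refl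
sumFin-cong (suc n) f≡g = cong₂ ℚ._+_ (f≡g Fin.zero) (sumFin-cong n (f≡g ∘ Fin.suc))

ι-sumFin : ∀ m (φ : ℕ → ℚ) → ι (sumFin (suc m) (φ ∘ toℕ)) ≡ ∑≤ m (ι ∘ φ)
ι-sumFin zero    φ = cong ι (ℚ.+-identityʳ (φ 0))
ι-sumFin (suc m) φ = trans (cong (ι (φ 0) ⊕_) (ι-sumFin m (φ ∘ suc))) (sym (∑≤-shift m (ι ∘ φ)))

bernVec-recurrence : ∀ m →
  sumFin (suc m) (λ i → ℕ→ℚ (suc (suc m) C toℕ i) ℚ.* lookup (bernVec m) i)
    ℚ.+ ℕ→ℚ (suc (suc m)) ℚ.* bernoulli (suc m) ≡ 0ℚ
bernVec-recurrence m = begin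
  S ℚ.+ N ℚ.* bernoulli (suc m)       ≡⟨ cong (λ b → S ℚ.+ N ℚ.* b) (lookup-∷ʳ-fromℕ (bernVec m) _) ⟩
  S ℚ.+ N ℚ.* (ℚ.- (S ℚ.* r))         ≡⟨ solve 3 (λ s n r → s :+ n :* (:- (s :* r)) := s :+ :- (s :* (n :* r))) refl S N r ⟩
  S ℚ.+ ℚ.- (S ℚ.* (N ℚ.* r))         ≡⟨ cong (λ t → S ℚ.+ ℚ.- (S ℚ.* t)) (ℕ→ℚ-*-recipℕ (suc m)) ⟩
  S ℚ.+ ℚ.- (S ℚ.* 1ℚ)                ≡⟨ solve 1 (λ s → s :+ :- (s :* con 1ℚ) := con 0ℚ) refl S ⟩
  0ℚ                                   ∎
  where
  open ≡-Reasoning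
  open ℚ-Solver
  S = sumFin (suc m) (λ i → ℕ→ℚ (suc (suc m) C toℕ i) ℚ.* lookup (bernVec m) i)
  N = ℕ→ℚ (suc (suc m))
  r = recipℕ (suc (suc m))

bernoulli5 : Seq
bernoulli5 i = ι (bernoulli i)

bernoulli5-recurrence : ∀ m →
  ∑≤ (suc m) (λ k → fromℕ (suc (suc m) C k) ⊗ (one5 ⊗ bernoulli5 k)) ≡ zero5
bernoulli5-recurrence m = begin
  ∑≤ m g ⊕ g (suc m)
    ≡⟨ cong₂ _⊕_ (∑≤-cong m (λ k _ → g≡ιφ k))
                 (trans (g≡ιφ (suc m)) (cong (λ c → ι (ℕ→ℚ c ℚ.* bernoulli (suc m))) C-last)) ⟩
  ∑≤ m (ι ∘ φ) ⊕ ι (N ℚ.* bernoulli (suc m))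
    ≡⟨ cong (_⊕ ι (N ℚ.* bernoulli (suc m))) (sym (ι-sumFin m φ)) ⟩
  ι (sumFin (suc m) (φ ∘ toℕ)) ⊕ ι (N ℚ.* bernoulli (suc m))
    ≡⟨ cong (λ t → ι t ⊕ ι (N ℚ.* bernoulli (suc m)))
            (sumFin-cong (suc m) (λ i → cong (ℕ→ℚ (suc (suc m) C toℕ i) ℚ.*_) (sym (lookup-bernVec m i)))) ⟩
  ι (sumFin (suc m) (λ i → ℕ→ℚ (suc (suc m) C toℕ i) ℚ.* lookup (bernVec m) i) ℚ.+ N ℚ.* bernoulli (suc m))
    ≡⟨ cong ι (bernVec-recurrence m) ⟩
  zero5 ∎
  where
  open ≡-Reasoning
  N = ℕ→ℚ (suc (suc m))
  g : Seq
  g k = fromℕ (suc (suc m) C k) ⊗ (one5 ⊗ bernoulli5 k)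
  φ : ℕ → ℚ
  φ k = ℕ→ℚ (suc (suc m) C k) ℚ.* bernoulli k
  g≡ιφ : ∀ k → g k ≡ ι (φ k)
  g≡ιφ k = begin
    fromℕ c ⊗ (one5 ⊗ bernoulli5 k) ≡⟨ cong₂ _⊗_ (sym (nat5≡fromℕ c)) (⊗-identityˡ _) ⟩
    nat5 c ⊗ bernoulli5 k           ≡⟨ sym (ι-⊗ (ℕ→ℚ c) (bernoulli k)) ⟩
    ι (φ k)                         ∎
    where c = suc (suc m) C k
  C-last : suc (suc m) C suc m ≡ suc (suc m)
  C-last = trans (nCk≡nC[n∸k] (ℕ.n≤1+n (suc m)))
                 (trans (cong (suc (suc m) C_) (ℕ.m+n∸n≡m 1 m)) (nC1≡n (suc (suc m))))

bernoulli5-⋆-𝟙 : bernoulli5 ⋆ 𝟙 ≐ λ n → bernoulli5 n ⊕ δ₁ n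
bernoulli5-⋆-𝟙 zero          = trans (⊗-identityʳ (bernoulli5 0)) (sym (⊕-identityʳ (bernoulli5 0)))
bernoulli5-⋆-𝟙 (suc zero)    = cong₂ _⊕_ (⊗-identityʳ (bernoulli5 1)) (⊗-identityʳ (bernoulli5 0))
bernoulli5-⋆-𝟙 (suc (suc m)) = begin
  (bernoulli5 ⋆ 𝟙) (suc (suc m))
    ≡⟨ ⋆-comm bernoulli5 𝟙 (suc (suc m)) ⟩
  (𝟙 ⋆ bernoulli5) (suc (suc m))
    ≡⟨ ⋆-binomialSum 𝟙 bernoulli5 (suc (suc m)) ⟩
  ∑≤ (suc m) (λ k → fromℕ (suc (suc m) C k) ⊗ (one5 ⊗ bernoulli5 k))
    ⊕ fromℕ (suc (suc m) C suc (suc m)) ⊗ (one5 ⊗ b)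
    ≡⟨ cong₂ (λ s c → s ⊕ fromℕ c ⊗ (one5 ⊗ b)) (bernoulli5-recurrence m) (nCn≡1 (suc (suc m))) ⟩
  zero5 ⊕ fromℕ 1 ⊗ (one5 ⊗ b)
    ≡⟨ Q5-Solver.solve 1 (λ b → con zero5 :+ (con one5 :+ con zero5) :* (con one5 :* b) := b :+ con zero5)
                         refl b ⟩
  b ⊕ zero5 ∎
  where
  open ≡-Reasoning
  open Q5-Solver using (_:+_; _:*_; _:=_; con)
  b = bernoulli5 (suc (suc m))

module Corollary15 (k j p : ℕ) where

  open ≡-Reasoning
  open Q5-Solver using (_:+_; _:*_; _:-_; _:=_; con)

  n q : ℕ
  n = suc k
  q = suc (suc p)

  x a b Q r h N : Q5
  x = √5 ⊗ nat5 (fib j)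
  a = α ^ j
  b = β ^ j
  Q = nat5 q
  r = ι (recipℕ q)
  h = x ⊗ r
  N = fromℕ n

  Q⊗r≡1 : Q ⊗ r ≡ one5
  Q⊗r≡1 = nat5-*-recip (suc p)

  Q⊗h≡x : Q ⊗ h ≡ x
  Q⊗h≡x = begin
    Q ⊗ (x ⊗ r)   ≡⟨ Q5-Solver.solve 3 (λ Q x r → Q :* (x :* r) := (Q :* r) :* x) refl Q x r ⟩
    (Q ⊗ r) ⊗ x   ≡⟨ cong (_⊗ x) Q⊗r≡1 ⟩
    one5 ⊗ x      ≡⟨ ⊗-identityˡ x ⟩
    x             ∎

  a≡b⊕x : a ≡ b ⊕ x
  a≡b⊕x = begin
    a               ≡⟨ Q5-Solver.solve 2 (λ a b → a := b :+ (a :- b)) refl a b ⟩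
    b ⊕ (a ⊖ b)     ≡⟨ cong (b ⊕_) (sym (binet j)) ⟩
    b ⊕ x           ∎

  a≡b⊕Q⊗h : a ≡ b ⊕ Q ⊗ h
  a≡b⊕Q⊗h = trans a≡b⊕x (cong (b ⊕_) (sym Q⊗h≡x))

  P : Q5 → Q5 → Q5
  P h y = homBernoulli bernoulli5 h y n

  term : Q5 → Q5 → ℕ → Q5
  term h y i = fromℕ (n C i) ⊗ ((bernoulli5 (n ∸ i) ⊗ h ^ (n ∸ i)) ⊗ y ^ i)

  P-expansion : ∀ h y → P h y ≡ ∑≤ n (term h y)
  P-expansion h y = ⋆-binomialSum (λ i → bernoulli5 i ⊗ h ^ i) (y ^_) n

  lhsTerm : ℕ → Q5
  lhsTerm i = nat5 (n C i) ⊗ ((√5 ⊗ nat5 (fib j)) ^5 (n ∸ i)) ⊗ (qPow1m q (n ∸ i) ⊖ one5)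
              ⊗ nat5 (fib (j * i)) ⊗ ι (bernoulli (n ∸ i))

  √5⊗lhsTerm : ∀ i → √5 ⊗ lhsTerm i ≡ Q ⊗ (term h a i ⊖ term h b i) ⊖ (term x a i ⊖ term x b i)
  √5⊗lhsTerm i = begin
    √5 ⊗ lhsTerm i
      ≡⟨ cong₂ (λ c X → √5 ⊗ (c ⊗ X ⊗ (Q ⊗ r ^5 m ⊖ one5) ⊗ F ⊗ B))
               (nat5≡fromℕ (n C i)) (sym (^≡^5 x m)) ⟩
    √5 ⊗ (c ⊗ X ⊗ (Q ⊗ r ^5 m ⊖ one5) ⊗ F ⊗ B)
      ≡⟨ cong (λ R → √5 ⊗ (c ⊗ X ⊗ (Q ⊗ R ⊖ one5) ⊗ F ⊗ B)) (sym (^≡^5 r m)) ⟩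
    √5 ⊗ (c ⊗ X ⊗ (Q ⊗ R ⊖ one5) ⊗ F ⊗ B)
      ≡⟨ Q5-Solver.solve 7 (λ s c X Q R F B → s :* (c :* X :* (Q :* R :- con one5) :* F :* B)
                                           := c :* X :* (Q :* R :- con one5) :* (s :* F) :* B)
                           refl √5 c X Q R F B ⟩
    c ⊗ X ⊗ (Q ⊗ R ⊖ one5) ⊗ (√5 ⊗ F) ⊗ B
      ≡⟨ cong (λ t → c ⊗ X ⊗ (Q ⊗ R ⊖ one5) ⊗ t ⊗ B) √5⊗F ⟩
    c ⊗ X ⊗ (Q ⊗ R ⊖ one5) ⊗ (a ^ i ⊖ b ^ i) ⊗ B
      ≡⟨ Q5-Solver.solve 7 (λ c X Q R A A′ B → c :* X :* (Q :* R :- con one5) :* (A :- A′) :* B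
                            := Q :* (c :* ((B :* (X :* R)) :* A) :- c :* ((B :* (X :* R)) :* A′))
                               :- (c :* ((B :* X) :* A) :- c :* ((B :* X) :* A′)))
                           refl c X Q R (a ^ i) (b ^ i) B ⟩
    Q ⊗ (c ⊗ ((B ⊗ (X ⊗ R)) ⊗ a ^ i) ⊖ c ⊗ ((B ⊗ (X ⊗ R)) ⊗ b ^ i))
      ⊖ (term x a i ⊖ term x b i)
      ≡⟨ cong (λ H → Q ⊗ (c ⊗ ((B ⊗ H) ⊗ a ^ i) ⊖ c ⊗ ((B ⊗ H) ⊗ b ^ i)) ⊖ (term x a i ⊖ term x b i))
              (sym (^-distrib-* x r m)) ⟩
    Q ⊗ (term h a i ⊖ term h b i) ⊖ (term x a i ⊖ term x b i) ∎
    where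
    m = n ∸ i
    c = fromℕ (n C i)
    X = x ^ m
    R = r ^ m
    F = nat5 (fib (j * i))
    B = bernoulli5 m
    √5⊗F : √5 ⊗ F ≡ a ^ i ⊖ b ^ i
    √5⊗F = trans (binet (j * i)) (sym (cong₂ _⊖_ (^-assocʳ α j i) (^-assocʳ β j i)))

  √5⊗lhs-as-P : √5 ⊗ sum5 n lhsTerm ≡ Q ⊗ (P h a ⊖ P h b) ⊖ (P x a ⊖ P x b)
  √5⊗lhs-as-P = begin
    √5 ⊗ sum5 n lhsTerm
      ≡⟨ cong (√5 ⊗_) (sym (∑≤≡sum5 n lhsTerm)) ⟩
    √5 ⊗ ∑≤ n lhsTerm
      ≡⟨ sym (∑≤-*ˡ n √5 lhsTerm) ⟩
    ∑≤ n (λ i → √5 ⊗ lhsTerm i)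
      ≡⟨ ∑≤-cong n (λ i _ → √5⊗lhsTerm i) ⟩
    ∑≤ n (λ i → Q ⊗ (term h a i ⊖ term h b i) ⊖ (term x a i ⊖ term x b i))
      ≡⟨ ∑≤-⊖ n _ _ ⟩
    ∑≤ n (λ i → Q ⊗ (term h a i ⊖ term h b i)) ⊖ ∑≤ n (λ i → term x a i ⊖ term x b i)
      ≡⟨ cong₂ _⊖_ (trans (∑≤-*ˡ n Q _) (cong (Q ⊗_) (∑≤-⊖ n _ _))) (∑≤-⊖ n _ _) ⟩
    Q ⊗ (∑≤ n (term h a) ⊖ ∑≤ n (term h b)) ⊖ (∑≤ n (term x a) ⊖ ∑≤ n (term x b))
      ≡⟨ sym (cong₂ _⊖_ (cong (Q ⊗_) (cong₂ _⊖_ (P-expansion h a) (P-expansion h b)))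
                        (cong₂ _⊖_ (P-expansion x a) (P-expansion x b))) ⟩
    Q ⊗ (P h a ⊖ P h b) ⊖ (P x a ⊖ P x b) ∎

  shifted : ℕ → Q5
  shifted i = (b ⊕ fromℕ i ⊗ h) ^ k

  P-h-difference : P h a ⊖ P h b ≡ N ⊗ (h ⊗ ∑≤ (suc p) shifted)
  P-h-difference = begin
    P h a ⊖ P h b
      ≡⟨ cong (λ y → P h y ⊖ P h b) (trans a≡b⊕Q⊗h (cong (λ c → b ⊕ c ⊗ h) (nat5≡fromℕ q))) ⟩
    P h (b ⊕ fromℕ q ⊗ h) ⊖ P h b
      ≡⟨ cong (_⊖ P h b) (homBernoulli-telescope bernoulli5-⋆-𝟙 h b k (suc p)) ⟩
    (P h b ⊕ N ⊗ (h ⊗ ∑≤ (suc p) shifted)) ⊖ P h b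
      ≡⟨ ⊕-⊖-cancelˡ (P h b) _ ⟩
    N ⊗ (h ⊗ ∑≤ (suc p) shifted) ∎

  P-x-difference : P x a ⊖ P x b ≡ N ⊗ (x ⊗ b ^ k)
  P-x-difference = begin
    P x a ⊖ P x b                        ≡⟨ cong (λ y → P x y ⊖ P x b) a≡b⊕x ⟩
    P x (b ⊕ x) ⊖ P x b                  ≡⟨ cong (_⊖ P x b) (homBernoulli-step bernoulli5-⋆-𝟙 x b k) ⟩
    (P x b ⊕ N ⊗ (x ⊗ b ^ k)) ⊖ P x b    ≡⟨ ⊕-⊖-cancelˡ (P x b) _ ⟩
    N ⊗ (x ⊗ b ^ k)                      ∎

  S : Q5
  S = ∑≤ p (shifted ∘ suc)

  √5⊗lhs : √5 ⊗ sum5 n lhsTerm ≡ N ⊗ (x ⊗ S)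
  √5⊗lhs = begin
    √5 ⊗ sum5 n lhsTerm
      ≡⟨ √5⊗lhs-as-P ⟩
    Q ⊗ (P h a ⊖ P h b) ⊖ (P x a ⊖ P x b)
      ≡⟨ cong₂ (λ d d′ → Q ⊗ d ⊖ d′) P-h-difference P-x-difference ⟩
    Q ⊗ (N ⊗ (h ⊗ ∑≤ (suc p) shifted)) ⊖ N ⊗ (x ⊗ b ^ k)
      ≡⟨ cong₂ (λ s y → Q ⊗ (N ⊗ (h ⊗ s)) ⊖ N ⊗ (y ⊗ b ^ k)) ∑≤-shifted (sym Q⊗h≡x) ⟩
    Q ⊗ (N ⊗ (h ⊗ (b ^ k ⊕ S))) ⊖ N ⊗ ((Q ⊗ h) ⊗ b ^ k)
      ≡⟨ Q5-Solver.solve 5 (λ Q N h B S → Q :* (N :* (h :* (B :+ S))) :- N :* ((Q :* h) :* B)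
                                       := N :* ((Q :* h) :* S))
                           refl Q N h (b ^ k) S ⟩
    N ⊗ ((Q ⊗ h) ⊗ S)
      ≡⟨ cong (λ y → N ⊗ (y ⊗ S)) Q⊗h≡x ⟩
    N ⊗ (x ⊗ S) ∎
    where
    ∑≤-shifted : ∑≤ (suc p) shifted ≡ b ^ k ⊕ S
    ∑≤-shifted = trans (∑≤-shift p shifted)
      (cong (λ y → y ^ k ⊕ S) (Q5-Solver.solve 2 (λ b h → b :+ con zero5 :* h := b) refl b h))

  rhsSummand : ℕ → Q5
  rhsSummand i = (nat5 i ⊗ (α ^5 j) ⊕ nat5 (q ∸ i) ⊗ (β ^5 j)) ^5 k

  -- i α^j + (q - i) β^j = q (β^j + i h), since α^j = β^j + q h.
  rhsSummand-suc : ∀ i → i ≤ p → rhsSummand (suc i) ≡ Q ^ k ⊗ shifted (suc i)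
  rhsSummand-suc i i≤p = begin
    (d ⊗ α ^5 j ⊕ c ⊗ β ^5 j) ^5 k
      ≡⟨ sym (trans (^≡^5 _ k) (cong₂ (λ A B → (d ⊗ A ⊕ c ⊗ B) ^5 k) (^≡^5 α j) (^≡^5 β j))) ⟩
    (d ⊗ a ⊕ c ⊗ b) ^ k
      ≡⟨ cong (λ t → (d ⊗ t ⊕ c ⊗ b) ^ k) a≡b⊕Q⊗h ⟩
    (d ⊗ (b ⊕ Q ⊗ h) ⊕ c ⊗ b) ^ k
      ≡⟨ cong (λ Q′ → (d ⊗ (b ⊕ Q′ ⊗ h) ⊕ c ⊗ b) ^ k) Q≡c⊕d ⟩
    (d ⊗ (b ⊕ (c ⊕ d) ⊗ h) ⊕ c ⊗ b) ^ k
      ≡⟨ cong (_^ k) (Q5-Solver.solve 4 (λ c d b h → d :* (b :+ (c :+ d) :* h) :+ c :* b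
                                                  := (c :+ d) :* (b :+ d :* h))
                                        refl c d b h) ⟩
    ((c ⊕ d) ⊗ (b ⊕ d ⊗ h)) ^ k
      ≡⟨ cong₂ (λ Q′ d′ → (Q′ ⊗ (b ⊕ d′ ⊗ h)) ^ k) (sym Q≡c⊕d) (nat5≡fromℕ (suc i)) ⟩
    (Q ⊗ (b ⊕ fromℕ (suc i) ⊗ h)) ^ k
      ≡⟨ ^-distrib-* Q _ k ⟩
    Q ^ k ⊗ shifted (suc i) ∎
    where
    c d : Q5
    c = nat5 (q ∸ suc i)
    d = nat5 (suc i)
    Q≡c⊕d : Q ≡ c ⊕ d
    Q≡c⊕d = trans (cong nat5 (sym (ℕ.m∸n+n≡m {q} {suc i} (ℕ.s≤s (ℕ.m≤n⇒m≤1+n i≤p)))))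
                  (nat5-+ (q ∸ suc i) (suc i))

  √5⊗rhs : √5 ⊗ (nat5 n ⊗ nat5 (fib j) ⊗ qPow1m q n ⊗ sumFromTo5 1 (q ∸ 1) rhsSummand)
           ≡ N ⊗ (x ⊗ S)
  √5⊗rhs = begin
    √5 ⊗ (nat5 n ⊗ F ⊗ (Q ⊗ r ^5 n) ⊗ sum5 p (rhsSummand ∘ suc))
      ≡⟨ cong₂ (λ R s → √5 ⊗ (nat5 n ⊗ F ⊗ (Q ⊗ R) ⊗ s))
               (sym (^≡^5 r n)) (sym (∑≤≡sum5 p (rhsSummand ∘ suc))) ⟩
    √5 ⊗ (nat5 n ⊗ F ⊗ (Q ⊗ (r ⊗ r ^ k)) ⊗ ∑≤ p (rhsSummand ∘ suc))
      ≡⟨ cong₂ (λ N′ s → √5 ⊗ (N′ ⊗ F ⊗ (Q ⊗ (r ⊗ r ^ k)) ⊗ s)) (nat5≡fromℕ n)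
               (trans (∑≤-cong p rhsSummand-suc) (∑≤-*ˡ p (Q ^ k) (shifted ∘ suc))) ⟩
    √5 ⊗ (N ⊗ F ⊗ (Q ⊗ (r ⊗ r ^ k)) ⊗ (Q ^ k ⊗ S))
      ≡⟨ Q5-Solver.solve 8 (λ s N F Q r R P S → s :* (N :* F :* (Q :* (r :* R)) :* (P :* S))
                                              := N :* ((s :* F) :* S) :* ((Q :* r) :* (P :* R)))
                           refl √5 N F Q r (r ^ k) (Q ^ k) S ⟩
    N ⊗ (x ⊗ S) ⊗ ((Q ⊗ r) ⊗ (Q ^ k ⊗ r ^ k))
      ≡⟨ cong₂ (λ u v → N ⊗ (x ⊗ S) ⊗ (u ⊗ v)) Q⊗r≡1 Q^k⊗r^k≡1 ⟩
    N ⊗ (x ⊗ S) ⊗ (one5 ⊗ one5)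
      ≡⟨ ⊗-identityʳ _ ⟩
    N ⊗ (x ⊗ S) ∎
    where
    F = nat5 (fib j)
    Q^k⊗r^k≡1 : Q ^ k ⊗ r ^ k ≡ one5
    Q^k⊗r^k≡1 = trans (sym (^-distrib-* Q r k)) (trans (cong (_^ k) Q⊗r≡1) (one5-^ k))

corollary15 : (n j q : ℕ) → 1 ≤ n → 1 ≤ j → 2 ≤ q →
    sum5 n (λ k → nat5 (n C k) ⊗ ((√5 ⊗ nat5 (fib j)) ^5 (n ∸ k))
                   ⊗ (qPow1m q (n ∸ k) ⊖ one5) ⊗ nat5 (fib (j * k))
                   ⊗ ι (bernoulli (n ∸ k)))
    ≡ nat5 n ⊗ nat5 (fib j) ⊗ qPow1m q n
        ⊗ sumFromTo5 1 (q ∸ 1)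
            (λ r → (nat5 r ⊗ (α ^5 j) ⊕ nat5 (q ∸ r) ⊗ (β ^5 j)) ^5 (n ∸ 1))
corollary15 zero    j q             ()    _ _
corollary15 (suc k) j zero          _ _ ()
corollary15 (suc k) j (suc zero)    _ _ (ℕ.s≤s ())
corollary15 (suc k) j (suc (suc p)) _ _ _ = √5-cancel (trans √5⊗lhs (sym √5⊗rhs))
  where open Corollary15 k j p
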